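{- Let $D$ be a dcpo with an apartness relation $\#$ (an irreflexive and symmetric binary relation). (i) If $D$ has elements $x,y$ with $x$ strictly below $y$, then tightness of $\#$ implies excluded middle. (ii) If $D$ has elements $x\sqsubseteq y$ with $x\# y$, then cotransitivity of $\#$ implies weak excluded middle.
   Context: We work constructively: informal set theory without excluded middle or choice. A dcpo is a poset in which every directed subset (inhabited, and any two elements have an upper bound in it) has a supremum $\bigsqcup S$. An element $x$ of a dcpo is strictly below $y$ if $x\sqsubseteq y$ and for every $z\sqsupseteq y$ and every proposition $P$, the equality $z=\bigsqcup(\{x\}\cup\{z\mid P\})$ implies $P$ (here $\{z\mid P\}$ is the subset containing $z$ exactly when $P$ holds). An apartness $\#$ on a set $X$ is tight if $\neg(x\# y)$ implies $x=y$, and cotransitive if $x\# y$ implies ($x\# z$ or $y\# z$) for all $x,y,z\in X$. Excluded middle: $P\vee\neg P$ for every proposition $P$. Weak excluded middle: $\neg P\vee\neg\neg P$ for every proposition $P$. -}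

module Defs where

open import Level using (Level; suc; zero)
open import Data.Product using (Σ; Σ-syntax; _×_; _,_)
open import Data.Sum using (_⊎_)
open import Data.Empty using (⊥)
open import Relation.Nullary using (¬_)
open import Relation.Binary.PropositionalEquality using (_≡_)

isProp : Set → Set
isProp P = (a b : P) → a ≡ b

isSet : Set → Set
isSet X = (x y : X) → isProp (x ≡ y)

Subset : Set → Set₁
Subset X = X → Set

module _ {X : Set} (_⊑_ : X → X → Set) where

  Directed : Subset X → Set
  Directed S = Σ[ x ∈ X ] S x
             × ((a b : X) → S a → S b → Σ[ c ∈ X ] (S c × (a ⊑ c) × (b ⊑ c)))

  IsSup : Subset X → X → Set
  IsSup S s = ((a : X) → S a → a ⊑ s)
            × ((u : X) → ((a : X) → S a → a ⊑ u) → s ⊑ u)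

record DCPO : Set₁ where
  field
    Carrier     : Set
    carrier-set : isSet Carrier
    _⊑_         : Carrier → Carrier → Set
    ⊑-prop      : (x y : Carrier) → isProp (x ⊑ y)
    ⊑-refl      : (x : Carrier) → x ⊑ x
    ⊑-trans     : {x y z : Carrier} → x ⊑ y → y ⊑ z → x ⊑ z
    ⊑-antisym   : {x y : Carrier} → x ⊑ y → y ⊑ x → x ≡ y
    ⨆           : (S : Subset Carrier) → Directed _⊑_ S → Carrier
    ⨆-isSup     : (S : Subset Carrier) (δ : Directed _⊑_ S) → IsSup _⊑_ S (⨆ S δ)

module _ (D : DCPO) where
  open DCPO D

  pair-subset : Carrier → Carrier → Set → Subset Carrier
  pair-subset x z P w = (w ≡ x) ⊎ ((w ≡ z) × P)

  -- x is strictly below y.  "z = ⨆ ({x} ∪ {z | P})" is expressed as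
  -- "z is the supremum of {x} ∪ {z | P}" (the subset is directed whenever
  -- x ⊑ z, and suprema are unique by antisymmetry).
  StrictlyBelow : Carrier → Carrier → Set₁
  StrictlyBelow x y =
    (x ⊑ y) ×
    ((z : Carrier) → y ⊑ z → (P : Set) → isProp P →
       IsSup _⊑_ (pair-subset x z P) z → P)

record IsApartness {X : Set} (_#_ : X → X → Set) : Set where
  field
    #-irrefl : (x : X) → ¬ (x # x)
    #-sym    : {x y : X} → x # y → y # x

Tight : {X : Set} → (X → X → Set) → Set
Tight {X} _#_ = (x y : X) → ¬ (x # y) → x ≡ y

Cotransitive : {X : Set} → (X → X → Set) → Set
Cotransitive {X} _#_ = (x y z : X) → x # y → (x # z) ⊎ (y # z)

ExcludedMiddle : Set₁
ExcludedMiddle = (P : Set) → isProp P → P ⊎ ¬ P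

WeakExcludedMiddle : Set₁
WeakExcludedMiddle = (P : Set) → isProp P → (¬ P) ⊎ (¬ ¬ P)

-- A proposition P is encoded by the element s P = ⨆ ({x} ∪ {y | P}) for fixed x ⊑ y:
-- P gives s P = y and ¬ P gives s P = x.  If x is strictly below y the encoding is
-- faithful (s P = y implies P), so tightness, which makes equality ¬¬-stable,
-- yields double-negation elimination and hence excluded middle.  If x # y,
-- cotransitivity at s P gives x # s P (so ¬¬ P) or y # s P (so ¬ P).
module Submission where

open import Defs
open import Data.Product using (Σ; Σ-syntax; _×_; _,_; proj₁; proj₂)
open import Data.Sum using (_⊎_; inj₁; inj₂; [_,_])
open import Data.Empty using (⊥; ⊥-elim)
open import Relation.Nullary using (¬_)
open import Relation.Binary.PropositionalEquality using (_≡_; _≢_; refl; sym; trans; subst)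

⊎-isProp : {P Q : Set} → isProp P → isProp Q → (P → ¬ Q) → isProp (P ⊎ Q)
⊎-isProp Pp Qp disjoint (inj₁ p) (inj₁ p′) rewrite Pp p p′ = refl
⊎-isProp Pp Qp disjoint (inj₁ p) (inj₂ q)  = ⊥-elim (disjoint p q)
⊎-isProp Pp Qp disjoint (inj₂ q) (inj₁ p)  = ⊥-elim (disjoint p q)
⊎-isProp Pp Qp disjoint (inj₂ q) (inj₂ q′) rewrite Qp q q′ = refl

-- Without function extensionality ¬ P need not be a proposition, so excluded
-- middle is derived from a propositional substitute N for ¬ P.
dne⇒em : ((R : Set) → isProp R → ¬ ¬ R → R) →
         (P : Set) → isProp P → (N : Set) → isProp N → (¬ P → N) → (N → ¬ P) →
         P ⊎ ¬ P
dne⇒em dne P Pp N Np ¬P⇒N N⇒¬P =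
  [ inj₁ , (λ n → inj₂ (N⇒¬P n)) ]
    (dne (P ⊎ N) (⊎-isProp Pp Np (λ p n → N⇒¬P n p))
         (λ ¬P⊎N → ¬P⊎N (inj₂ (¬P⇒N (λ p → ¬P⊎N (inj₁ p))))))

module _ {X : Set} {_#_ : X → X → Set} (ap : IsApartness _#_) where
  open IsApartness ap

  #⇒≢ : {a b : X} → a # b → a ≢ b
  #⇒≢ {a} a#b refl = #-irrefl a a#b

  tight⇒≡-stable : Tight _#_ → {a b : X} → ¬ ¬ (a ≡ b) → a ≡ b
  tight⇒≡-stable tight {a} {b} ¬¬a≡b = tight a b (λ a#b → ¬¬a≡b (#⇒≢ a#b))

module _ (D : DCPO) where
  open DCPO D

  IsSup-unique : {S : Subset Carrier} {a b : Carrier} →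
                 IsSup _⊑_ S a → IsSup _⊑_ S b → a ≡ b
  IsSup-unique (a-ub , a-least) (b-ub , b-least) =
    ⊑-antisym (a-least _ b-ub) (b-least _ a-ub)

  module _ {x z : Carrier} {P : Set} where

    pair-directed : x ⊑ z → Directed _⊑_ (pair-subset D x z P)
    pair-directed x⊑z = x , inj₁ refl , upper
      where
      upper : (a b : Carrier) → pair-subset D x z P a → pair-subset D x z P b →
              Σ[ c ∈ Carrier ] (pair-subset D x z P c × (a ⊑ c) × (b ⊑ c))
      upper _ _ (inj₁ refl)       (inj₁ refl)       = x , inj₁ refl , ⊑-refl x , ⊑-refl x
      upper _ _ (inj₁ refl)       (inj₂ (refl , p)) = z , inj₂ (refl , p) , x⊑z , ⊑-refl z
      upper _ _ (inj₂ (refl , p)) (inj₁ refl)       = z , inj₂ (refl , p) , ⊑-refl z , x⊑z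
      upper _ _ (inj₂ (refl , p)) (inj₂ (refl , _)) = z , inj₂ (refl , p) , ⊑-refl z , ⊑-refl z

    top-isSup-pair : x ⊑ z → P → IsSup _⊑_ (pair-subset D x z P) z
    top-isSup-pair x⊑z p = upper , λ u bounds → bounds z (inj₂ (refl , p))
      where
      upper : (a : Carrier) → pair-subset D x z P a → a ⊑ z
      upper _ (inj₁ refl)       = x⊑z
      upper _ (inj₂ (refl , _)) = ⊑-refl z

    bottom-isSup-pair : ¬ P → IsSup _⊑_ (pair-subset D x z P) x
    bottom-isSup-pair ¬p = upper , λ u bounds → bounds x (inj₁ refl)
      where
      upper : (a : Carrier) → pair-subset D x z P a → a ⊑ x
      upper _ (inj₁ refl)    = ⊑-refl x
      upper _ (inj₂ (_ , p)) = ⊥-elim (¬p p)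

  pair-sup : {x z : Carrier} → x ⊑ z → Set → Carrier
  pair-sup {x} {z} x⊑z P = ⨆ (pair-subset D x z P) (pair-directed x⊑z)

  module _ {x z : Carrier} (x⊑z : x ⊑ z) {P : Set} where

    pair-sup-isSup : IsSup _⊑_ (pair-subset D x z P) (pair-sup x⊑z P)
    pair-sup-isSup = ⨆-isSup (pair-subset D x z P) (pair-directed x⊑z)

    pair-sup≡top : P → pair-sup x⊑z P ≡ z
    pair-sup≡top p = IsSup-unique pair-sup-isSup (top-isSup-pair x⊑z p)

    pair-sup≡bottom : ¬ P → pair-sup x⊑z P ≡ x
    pair-sup≡bottom ¬p = IsSup-unique pair-sup-isSup (bottom-isSup-pair ¬p)

  module _ {x y : Carrier} (x≪y : StrictlyBelow D x y) where
    private
      x⊑y : x ⊑ y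
      x⊑y = proj₁ x≪y

      faithful : (P : Set) → isProp P → IsSup _⊑_ (pair-subset D x y P) y → P
      faithful = proj₂ x≪y y (⊑-refl y)

    strictlyBelow⇒≢ : x ≢ y
    strictlyBelow⇒≢ refl = faithful ⊥ (λ ()) (bottom-isSup-pair (λ ()))

    pair-sup≡top⇒ : {P : Set} → isProp P → pair-sup x⊑y P ≡ y → P
    pair-sup≡top⇒ {P} Pp eq =
      faithful P Pp (subst (IsSup _⊑_ (pair-subset D x y P)) eq (pair-sup-isSup x⊑y))

    tight⇒dne : {_#_ : Carrier → Carrier → Set} → IsApartness _#_ → Tight _#_ →
                (R : Set) → isProp R → ¬ ¬ R → R
    tight⇒dne ap tight R Rp ¬¬r =
      pair-sup≡top⇒ Rp
        (tight⇒≡-stable ap tight (λ s≢y → ¬¬r (λ r → s≢y (pair-sup≡top x⊑y r))))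

    tight⇒em : {_#_ : Carrier → Carrier → Set} → IsApartness _#_ → Tight _#_ →
               ExcludedMiddle
    tight⇒em ap tight P Pp =
      dne⇒em (tight⇒dne ap tight) P Pp
        (pair-sup x⊑y (¬ P) ≡ y) (carrier-set _ _)
        (pair-sup≡top x⊑y)
        (λ s≡y p → strictlyBelow⇒≢ (trans (sym (pair-sup≡bottom x⊑y (λ ¬p → ¬p p))) s≡y))

  cotransitive⇒wem : {_#_ : Carrier → Carrier → Set} → IsApartness _#_ →
                     {x y : Carrier} → x ⊑ y → x # y → Cotransitive _#_ →
                     WeakExcludedMiddle
  cotransitive⇒wem ap {x} {y} x⊑y x#y cotrans P _ =
    [ (λ x#s → inj₂ (λ ¬p → #⇒≢ ap x#s (sym (pair-sup≡bottom x⊑y ¬p))))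
    , (λ y#s → inj₁ (λ p → #⇒≢ ap y#s (sym (pair-sup≡top x⊑y p))))
    ] (cotrans x y (pair-sup x⊑y P) x#y)

theorem5p6 : (D : DCPO) (_#_ : DCPO.Carrier D → DCPO.Carrier D → Set)
    → IsApartness _#_
    → ((Σ[ x ∈ DCPO.Carrier D ] Σ[ y ∈ DCPO.Carrier D ] StrictlyBelow D x y)
         → Tight _#_ → ExcludedMiddle)
    × ((Σ[ x ∈ DCPO.Carrier D ] Σ[ y ∈ DCPO.Carrier D ] (DCPO._⊑_ D x y × (x # y)))
         → Cotransitive _#_ → WeakExcludedMiddle)
theorem5p6 D _#_ ap =
    (λ { (x , y , x≪y) → tight⇒em D x≪y ap })
  , (λ { (x , y , x⊑y , x#y) → cotransitive⇒wem D ap x⊑y x#y })
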